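{- Let $k\geq 3$ be an integer and $d=2^k-1$. Then $r_{d}=r_{2d}=r_{3d}=\cdots=r_{2^{k-1}d}$, and this common value equals $(k-1)\bmod 2$. Moreover, if $k$ is odd, then $r_{(2^{k-1}+1)d}=k \bmod 2$, and consequently $A_{\mathbf{r}}(0,d)=(d+3)/2$.
   Context: For $n\in\mathbb{N}$, $e_{11}(n)$ is the number of (possibly overlapping) occurrences of $11$ in the binary expansion of $n$, and $r_n=e_{11}(n)\bmod 2$. For $d\geq 1$, $A_{\mathbf{r}}(0,d)=\inf\{l\geq 1: r_{ld}\neq r_0\}$. -}

module Defs where

open import Data.Nat using (ℕ; zero; suc; _+_; _*_; _≤_; _<_)
open import Data.Nat.DivMod using (_/_; _%_)
open import Data.Bool using (Bool; true; false; _∧_; if_then_else_)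
open import Data.List using (List; []; _∷_)
open import Data.Product using (_×_)
open import Relation.Binary.PropositionalEquality using (_≡_; _≢_)

-- Binary digits of n, least significant first, no leading zeros
-- (bits of 0 is the empty list). The first argument is fuel; fuel n suffices.
bitsF : ℕ → ℕ → List Bool
bitsF zero    _ = []
bitsF (suc f) zero = []
bitsF (suc f) n@(suc _) = (if n % 2 Data.Nat.≡ᵇ 1 then true else false) ∷ bitsF f (n / 2)

binary : ℕ → List Bool
binary n = bitsF n n

count11 : List Bool → ℕ
count11 []            = 0
count11 (_ ∷ [])      = 0
count11 (a ∷ b ∷ bs)  = (if a ∧ b then 1 else 0) + count11 (b ∷ bs)

e11 : ℕ → ℕ
e11 n = count11 (binary n)

r : ℕ → ℕ
r n = e11 n % 2

-- m = A_r(0,d) = inf { l ≥ 1 : r (l d) ≠ r 0 }  (infimum attained, i.e. minimum)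
IsA0 : ℕ → ℕ → Set
IsA0 d m = (1 ≤ m) × (r (m * d) ≢ r 0) × (∀ l → 1 ≤ l → l < m → r (l * d) ≡ r 0)

-- For m < 2^n let w be the n-bit binary word of m (least significant bit first). Since
-- (m+1)(2^n-1) = m·2^n + (2^n-1-m), the binary word of (m+1)(2^n-1) is the complement of w
-- followed by w. Each of the n-1 adjacent pairs of w is a 11 of w, a 11 of its complement, or a
-- change of bit, and the number of changes has the parity of (first bit + last bit) of w. Adding
-- the possible 11 at the junction, e11((m+1)(2^n-1)) ≡ n-1 + [w ends in 1 and starts with 0]
-- (mod 2). With n = k and m < 2^(k-1) the last bit is 0, giving (k-1) mod 2; the multiplier
-- 2^(k-1)+1 has w = 0…01, giving k mod 2. For odd k these differ, so A(0,d) = 2^(k-1)+1.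
module Submission where

open import Defs
open import Data.Bool using (Bool; true; false; not; _∧_; _xor_; if_then_else_)
open import Data.Bool.Properties using (∧-zeroʳ)
open import Data.List using (List; []; _∷_; _++_; _∷ʳ_; map; length; replicate)
open import Data.List.Properties using (length-map; length-replicate)
open import Data.Nat
open import Data.Nat.DivMod
open import Data.Nat.Divisibility using (m∣m*n)
open import Data.Nat.Properties
open import Data.Nat.Tactic.RingSolver using (solve-∀)
open import Data.Parity.Base as ℙ using (0ℙ)
open import Data.Parity.Properties as ℙ using (+-homo-+)
open import Data.Product using (Σ-syntax; _×_; _,_)
open import Relation.Binary.PropositionalEquality using (_≡_; _≢_; refl; sym; trans; cong; cong₂; subst; module ≡-Reasoning)
open ≡-Reasoning

bit : Bool → ℕ
bit b = if b then 1 else 0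

headBit : List Bool → Bool
headBit []      = false
headBit (b ∷ _) = b

lastBit : List Bool → Bool
lastBit []          = false
lastBit (b ∷ [])    = b
lastBit (_ ∷ b ∷ w) = lastBit (b ∷ w)

⟦_⟧ : List Bool → ℕ
⟦ [] ⟧    = 0
⟦ b ∷ w ⟧ = bit b + 2 * ⟦ w ⟧

lowBit : ℕ → Bool
lowBit m = if m % 2 ≡ᵇ 1 then true else false

digits : ℕ → ℕ → List Bool
digits zero    m = []
digits (suc n) m = lowBit m ∷ digits n (m / 2)

changes : List Bool → ℕ
changes []          = 0
changes (_ ∷ [])    = 0
changes (a ∷ b ∷ w) = bit (a xor b) + changes (b ∷ w)

[1+n]/2≤n : ∀ n → suc n / 2 ≤ n
[1+n]/2≤n n = s≤s⁻¹ (m/n<m (suc n) 2 (s≤s (s≤s z≤n)))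

bitsF-fuel : ∀ {f g n} → n ≤ f → n ≤ g → bitsF f n ≡ bitsF g n
bitsF-fuel {zero}  {zero}  {zero} _ _ = refl
bitsF-fuel {zero}  {suc g} {zero} _ _ = refl
bitsF-fuel {suc f} {zero}  {zero} _ _ = refl
bitsF-fuel {suc f} {suc g} {zero} _ _ = refl
bitsF-fuel {suc f} {suc g} {suc n} (s≤s n≤f) (s≤s n≤g) =
  cong (_ ∷_) (bitsF-fuel (≤-trans ([1+n]/2≤n n) n≤f) (≤-trans ([1+n]/2≤n n) n≤g))

binary-unfold : ∀ m → 0 < m → binary m ≡ lowBit m ∷ binary (m / 2)
binary-unfold (suc m) _ = cong (lowBit (suc m) ∷_) (bitsF-fuel ([1+n]/2≤n m) ≤-refl)

bit%2≡bit : ∀ b → bit b % 2 ≡ bit b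
bit%2≡bit true  = refl
bit%2≡bit false = refl

[bit+2*k]%2≡bit : ∀ b k → (bit b + 2 * k) % 2 ≡ bit b
[bit+2*k]%2≡bit b k = begin
  (bit b + 2 * k) % 2 ≡⟨ cong (λ x → (bit b + x) % 2) (*-comm 2 k) ⟩
  (bit b + k * 2) % 2 ≡⟨ [m+kn]%n≡m%n (bit b) k 2 ⟩
  bit b % 2           ≡⟨ bit%2≡bit b ⟩
  bit b               ∎

[bit+2*k]/2≡k : ∀ b k → (bit b + 2 * k) / 2 ≡ k
[bit+2*k]/2≡k b k = begin
  (bit b + 2 * k) / 2   ≡⟨ +-distrib-/-∣ʳ (bit b) (m∣m*n k) ⟩
  bit b / 2 + 2 * k / 2 ≡⟨ cong₂ _+_ (m<n⇒m/n≡0 (bit<2 b)) (cong (_/ 2) (*-comm 2 k)) ⟩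
  k * 2 / 2             ≡⟨ m*n/n≡m k 2 ⟩
  k                     ∎
  where
  bit<2 : ∀ b → bit b < 2
  bit<2 true  = s≤s (s≤s z≤n)
  bit<2 false = s≤s z≤n

binary-cons : ∀ b n → binary (bit b + 2 * suc n) ≡ b ∷ binary (suc n)
binary-cons b n = begin
  binary m                  ≡⟨ binary-unfold m (≤-trans (s≤s z≤n) (m≤n+m _ (bit b))) ⟩
  lowBit m ∷ binary (m / 2) ≡⟨ cong₂ _∷_ lowest-digit (cong binary ([bit+2*k]/2≡k b (suc n))) ⟩
  b ∷ binary (suc n)        ∎
  where
  m = bit b + 2 * suc n
  bit≡ᵇ1 : ∀ b → (if bit b ≡ᵇ 1 then true else false) ≡ b
  bit≡ᵇ1 true  = refl
  bit≡ᵇ1 false = refl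
  lowest-digit : lowBit m ≡ b
  lowest-digit = trans (cong (λ x → if x ≡ᵇ 1 then true else false) ([bit+2*k]%2≡bit b (suc n))) (bit≡ᵇ1 b)

binary-⟦⟧ : ∀ w → Σ[ z ∈ ℕ ] binary ⟦ w ⟧ ++ replicate z false ≡ w
binary-⟦⟧ []      = 0 , refl
binary-⟦⟧ (b ∷ w) with binary-⟦⟧ w
... | z , eq = cons b ⟦ w ⟧ eq
  where
  cons : ∀ b n {w} → binary n ++ replicate z false ≡ w →
         Σ[ z′ ∈ ℕ ] binary (bit b + 2 * n) ++ replicate z′ false ≡ b ∷ w
  cons true  zero    eq = z , cong (true ∷_) eq
  cons false zero    eq = suc z , cong (false ∷_) eq
  cons b     (suc n) eq = z , trans (cong (_++ _) (binary-cons b n)) (cong (b ∷_) eq)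

count11-∷ : ∀ b w → count11 (b ∷ w) ≡ bit (b ∧ headBit w) + count11 w
count11-∷ true  []      = refl
count11-∷ false []      = refl
count11-∷ b     (_ ∷ _) = refl

count11-++ : ∀ u v → count11 (u ++ v) ≡ count11 u + bit (lastBit u ∧ headBit v) + count11 v
count11-++ []          v = refl
count11-++ (a ∷ [])    v = count11-∷ a v
count11-++ (a ∷ b ∷ u) v = begin
  bit (a ∧ b) + count11 (b ∷ u ++ v)                                 ≡⟨ cong (bit (a ∧ b) +_) (count11-++ (b ∷ u) v) ⟩
  bit (a ∧ b) + (count11 (b ∷ u) + bit (lastBit (b ∷ u) ∧ headBit v) + count11 v) ≡⟨ reassoc (bit (a ∧ b)) _ _ _ ⟩
  bit (a ∧ b) + count11 (b ∷ u) + bit (lastBit (b ∷ u) ∧ headBit v) + count11 v   ∎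
  where
  reassoc : ∀ p q s t → p + (q + s + t) ≡ p + q + s + t
  reassoc = solve-∀

headBit-replicate-false : ∀ z → headBit (replicate z false) ≡ false
headBit-replicate-false zero    = refl
headBit-replicate-false (suc z) = refl

count11-replicate-false : ∀ z → count11 (replicate z false) ≡ 0
count11-replicate-false zero          = refl
count11-replicate-false (suc zero)    = refl
count11-replicate-false (suc (suc z)) = count11-replicate-false (suc z)

count11-++-replicate-false : ∀ u z → count11 (u ++ replicate z false) ≡ count11 u
count11-++-replicate-false u z
  rewrite count11-++ u (replicate z false)
        | headBit-replicate-false z | ∧-zeroʳ (lastBit u) | count11-replicate-false z
  = trans (+-identityʳ _) (+-identityʳ _)

e11-⟦⟧ : ∀ w → e11 ⟦ w ⟧ ≡ count11 w
e11-⟦⟧ w with binary-⟦⟧ w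
... | z , eq = trans (sym (count11-++-replicate-false (binary ⟦ w ⟧) z)) (cong count11 eq)

⟦++⟧ : ∀ u v → ⟦ u ++ v ⟧ ≡ ⟦ u ⟧ + 2 ^ length u * ⟦ v ⟧
⟦++⟧ []      v = sym (+-identityʳ ⟦ v ⟧)
⟦++⟧ (b ∷ u) v = begin
  bit b + 2 * ⟦ u ++ v ⟧                        ≡⟨ cong (λ x → bit b + 2 * x) (⟦++⟧ u v) ⟩
  bit b + 2 * (⟦ u ⟧ + 2 ^ length u * ⟦ v ⟧)     ≡⟨ distrib (bit b) ⟦ u ⟧ (2 ^ length u) ⟦ v ⟧ ⟩
  bit b + 2 * ⟦ u ⟧ + 2 * 2 ^ length u * ⟦ v ⟧   ∎
  where
  distrib : ∀ p q s t → p + 2 * (q + s * t) ≡ p + 2 * q + 2 * s * t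
  distrib = solve-∀

⟦map-not⟧+⟦⟧ : ∀ w → suc (⟦ map not w ⟧ + ⟦ w ⟧) ≡ 2 ^ length w
⟦map-not⟧+⟦⟧ []      = refl
⟦map-not⟧+⟦⟧ (b ∷ w) = begin
  suc (bit (not b) + 2 * N + (bit b + 2 * M)) ≡⟨ regroup (bit (not b)) (bit b) N M ⟩
  suc (bit (not b) + bit b) + 2 * (N + M)     ≡⟨ cong (λ x → suc x + 2 * (N + M)) (bit-not+bit b) ⟩
  2 + 2 * (N + M)                             ≡⟨ sym (*-suc 2 (N + M)) ⟩
  2 * suc (N + M)                             ≡⟨ cong (2 *_) (⟦map-not⟧+⟦⟧ w) ⟩
  2 * 2 ^ length w                            ∎
  where
  N = ⟦ map not w ⟧
  M = ⟦ w ⟧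
  regroup : ∀ p q s t → suc (p + 2 * s + (q + 2 * t)) ≡ suc (p + q) + 2 * (s + t)
  regroup = solve-∀
  bit-not+bit : ∀ b → bit (not b) + bit b ≡ 1
  bit-not+bit true  = refl
  bit-not+bit false = refl

⟦map-not-++⟧ : ∀ w → ⟦ map not w ++ w ⟧ ≡ suc ⟦ w ⟧ * (2 ^ length w ∸ 1)
⟦map-not-++⟧ w = begin
  ⟦ map not w ++ w ⟧                    ≡⟨ ⟦++⟧ (map not w) w ⟩
  N + 2 ^ length (map not w) * M        ≡⟨ cong (λ n → N + 2 ^ n * M) (length-map not w) ⟩
  N + 2 ^ length w * M                  ≡⟨ cong (λ p → N + p * M) (sym (⟦map-not⟧+⟦⟧ w)) ⟩
  N + suc (N + M) * M                   ≡⟨ factor N M ⟩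
  suc M * (suc (N + M) ∸ 1)             ≡⟨ cong (λ p → suc M * (p ∸ 1)) (⟦map-not⟧+⟦⟧ w) ⟩
  suc M * (2 ^ length w ∸ 1)            ∎
  where
  N = ⟦ map not w ⟧
  M = ⟦ w ⟧
  factor : ∀ n m → n + suc (n + m) * m ≡ suc m * (n + m)
  factor = solve-∀

length-digits : ∀ n m → length (digits n m) ≡ n
length-digits zero    m = refl
length-digits (suc n) m = cong suc (length-digits n (m / 2))

⟦digits⟧ : ∀ n m → m < 2 ^ n → ⟦ digits n m ⟧ ≡ m
⟦digits⟧ zero    zero    _       = refl
⟦digits⟧ zero    (suc m) (s≤s ())
⟦digits⟧ (suc n) m       m<2^1+n = begin
  bit (lowBit m) + 2 * ⟦ digits n (m / 2) ⟧ ≡⟨ cong₂ (λ x y → x + 2 * y) (bit-lowBit m) (⟦digits⟧ n (m / 2) half<2^n) ⟩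
  m % 2 + 2 * (m / 2)                       ≡⟨ cong (m % 2 +_) (*-comm 2 (m / 2)) ⟩
  m % 2 + m / 2 * 2                         ≡⟨ sym (m≡m%n+[m/n]*n m 2) ⟩
  m                                         ∎
  where
  half<2^n : m / 2 < 2 ^ n
  half<2^n = m<n*o⇒m/o<n (subst (m <_) (*-comm 2 (2 ^ n)) m<2^1+n)
  bit-lowBit : ∀ m → bit (lowBit m) ≡ m % 2
  bit-lowBit zero          = refl
  bit-lowBit (suc zero)    = refl
  bit-lowBit (suc (suc m)) = bit-lowBit m

length-∷ʳ : ∀ (w : List Bool) b → length (w ∷ʳ b) ≡ suc (length w)
length-∷ʳ []      b = refl
length-∷ʳ (_ ∷ w) b = cong suc (length-∷ʳ w b)

lastBit-∷ʳ : ∀ w b → lastBit (w ∷ʳ b) ≡ b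
lastBit-∷ʳ []          b = refl
lastBit-∷ʳ (a ∷ [])    b = refl
lastBit-∷ʳ (a ∷ c ∷ w) b = lastBit-∷ʳ (c ∷ w) b

count11-map-not+count11+changes : ∀ w → count11 (map not w) + count11 w + changes w ≡ pred (length w)
count11-map-not+count11+changes []          = refl
count11-map-not+count11+changes (_ ∷ [])    = refl
count11-map-not+count11+changes (a ∷ b ∷ w) = begin
  (p₀₀ + N) + (p₁₁ + C) + (p≠ + D) ≡⟨ regroup p₀₀ p₁₁ p≠ N C D ⟩
  (p₀₀ + p₁₁ + p≠) + (N + C + D)   ≡⟨ cong₂ _+_ (pair a b) (count11-map-not+count11+changes (b ∷ w)) ⟩
  suc (length w)                   ∎
  where
  p₀₀ = bit (not a ∧ not b)
  p₁₁ = bit (a ∧ b)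
  p≠  = bit (a xor b)
  N = count11 (map not (b ∷ w))
  C = count11 (b ∷ w)
  D = changes (b ∷ w)
  regroup : ∀ p q s n c d → (p + n) + (q + c) + (s + d) ≡ (p + q + s) + (n + c + d)
  regroup = solve-∀
  pair : ∀ a b → bit (not a ∧ not b) + bit (a ∧ b) + bit (a xor b) ≡ 1
  pair true  true  = refl
  pair true  false = refl
  pair false true  = refl
  pair false false = refl

parity-changes : ∀ w → parity (changes w) ≡ parity (bit (headBit w)) ℙ.+ parity (bit (lastBit w))
parity-changes []          = refl
parity-changes (a ∷ [])    = sym (ℙ.p+p≡0ℙ (parity (bit a)))
parity-changes (a ∷ b ∷ w) = begin
  parity (bit (a xor b) + changes (b ∷ w)) ≡⟨ +-homo-+ (bit (a xor b)) (changes (b ∷ w)) ⟩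
  X ℙ.+ parity (changes (b ∷ w))           ≡⟨ cong (X ℙ.+_) (parity-changes (b ∷ w)) ⟩
  X ℙ.+ (parity (bit b) ℙ.+ L)             ≡⟨ ℙ.+-assoc X _ L ⟨
  X ℙ.+ parity (bit b) ℙ.+ L               ≡⟨ cong (ℙ._+ L) (telescope a b) ⟩
  parity (bit a) ℙ.+ L                     ∎
  where
  X = parity (bit (a xor b))
  L = parity (bit (lastBit (b ∷ w)))
  telescope : ∀ a b → parity (bit (a xor b)) ℙ.+ parity (bit b) ≡ parity (bit a)
  telescope true  true  = refl
  telescope true  false = refl
  telescope false true  = refl
  telescope false false = refl

lastBit-map-not : ∀ b w → lastBit (map not (b ∷ w)) ≡ not (lastBit (b ∷ w))
lastBit-map-not b []      = refl
lastBit-map-not b (c ∷ w) = lastBit-map-not c w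

count11-map-not-++ : ∀ w →
  count11 (map not w ++ w) + changes w ≡ pred (length w) + bit (not (lastBit w) ∧ headBit w)
count11-map-not-++ w = begin
  count11 (map not w ++ w) + D      ≡⟨ cong (_+ D) (count11-++ (map not w) w) ⟩
  N + bit (lastBit (map not w) ∧ headBit w) + C + D ≡⟨ cong (λ b → N + bit b + C + D) (junction w) ⟩
  N + J + C + D                     ≡⟨ regroup N J C D ⟩
  (N + C + D) + J                   ≡⟨ cong (_+ J) (count11-map-not+count11+changes w) ⟩
  pred (length w) + J               ∎
  where
  N = count11 (map not w)
  C = count11 w
  D = changes w
  J = bit (not (lastBit w) ∧ headBit w)
  regroup : ∀ n j c d → n + j + c + d ≡ (n + c + d) + j
  regroup = solve-∀
  junction : ∀ w → lastBit (map not w) ∧ headBit w ≡ not (lastBit w) ∧ headBit w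
  junction []      = refl
  junction (b ∷ w) = cong (_∧ b) (lastBit-map-not b w)

parity⇒%2≡ : ∀ m n → parity m ≡ parity n → m % 2 ≡ n % 2
parity⇒%2≡ (suc (suc m)) n             eq = parity⇒%2≡ m n eq
parity⇒%2≡ zero          (suc (suc n)) eq = parity⇒%2≡ zero n eq
parity⇒%2≡ (suc zero)    (suc (suc n)) eq = parity⇒%2≡ (suc zero) n eq
parity⇒%2≡ zero          zero          eq = refl
parity⇒%2≡ (suc zero)    (suc zero)    eq = refl
parity⇒%2≡ zero          (suc zero)    ()
parity⇒%2≡ (suc zero)    zero          ()

r-mersenne-multiple : ∀ w →
  r (suc ⟦ w ⟧ * (2 ^ length w ∸ 1)) ≡ (pred (length w) + bit (lastBit w ∧ not (headBit w))) % 2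
r-mersenne-multiple w = begin
  r (suc ⟦ w ⟧ * (2 ^ length w ∸ 1)) ≡⟨ cong r (sym (⟦map-not-++⟧ w)) ⟩
  e11 ⟦ X ⟧ % 2                      ≡⟨ cong (_% 2) (e11-⟦⟧ X) ⟩
  count11 X % 2                      ≡⟨ parity⇒%2≡ (count11 X) (P + bit (ℓ ∧ not h)) parity-count11 ⟩
  (P + bit (ℓ ∧ not h)) % 2          ∎
  where
  X = map not w ++ w
  P = pred (length w)
  h = headBit w
  ℓ = lastBit w
  c = parity (changes w)
  cancel : ∀ x y → x ℙ.+ c ≡ y → x ≡ y ℙ.+ c
  cancel x y eq = begin
    x                   ≡⟨ sym (ℙ.+-identityʳ x) ⟩
    x ℙ.+ 0ℙ            ≡⟨ cong (x ℙ.+_) (sym (ℙ.p+p≡0ℙ c)) ⟩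
    x ℙ.+ (c ℙ.+ c)     ≡⟨ sym (ℙ.+-assoc x c c) ⟩
    x ℙ.+ c ℙ.+ c       ≡⟨ cong (ℙ._+ c) eq ⟩
    y ℙ.+ c             ∎
  junction : ∀ h ℓ → parity (bit (not ℓ ∧ h)) ℙ.+ (parity (bit h) ℙ.+ parity (bit ℓ)) ≡ parity (bit (ℓ ∧ not h))
  junction true  true  = refl
  junction true  false = refl
  junction false true  = refl
  junction false false = refl
  count11+changes : parity (count11 X) ℙ.+ c ≡ parity P ℙ.+ parity (bit (not ℓ ∧ h))
  count11+changes = begin
    parity (count11 X) ℙ.+ c       ≡⟨ +-homo-+ (count11 X) (changes w) ⟨
    parity (count11 X + changes w) ≡⟨ cong parity (count11-map-not-++ w) ⟩
    parity (P + bit (not ℓ ∧ h))   ≡⟨ +-homo-+ P _ ⟩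
    parity P ℙ.+ parity (bit (not ℓ ∧ h)) ∎
  parity-count11 : parity (count11 X) ≡ parity (P + bit (ℓ ∧ not h))
  parity-count11 = begin
    parity (count11 X)                              ≡⟨ cancel _ _ count11+changes ⟩
    parity P ℙ.+ parity (bit (not ℓ ∧ h)) ℙ.+ c     ≡⟨ ℙ.+-assoc (parity P) _ c ⟩
    parity P ℙ.+ (parity (bit (not ℓ ∧ h)) ℙ.+ c)   ≡⟨ cong (λ x → parity P ℙ.+ (parity (bit (not ℓ ∧ h)) ℙ.+ x)) (parity-changes w) ⟩
    parity P ℙ.+ (parity (bit (not ℓ ∧ h)) ℙ.+ (parity (bit h) ℙ.+ parity (bit ℓ)))
                                                    ≡⟨ cong (parity P ℙ.+_) (junction h ℓ) ⟩
    parity P ℙ.+ parity (bit (ℓ ∧ not h))           ≡⟨ +-homo-+ P _ ⟨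
    parity (P + bit (ℓ ∧ not h))                    ∎

r-mersenne-multiple-< : ∀ n m → m < 2 ^ n → r (suc m * (2 ^ suc n ∸ 1)) ≡ n % 2
r-mersenne-multiple-< n m m<2^n = begin
  r (suc m * (2 ^ suc n ∸ 1))                        ≡⟨ cong₂ (λ a l → r (suc a * (2 ^ l ∸ 1))) (sym ⟦w⟧≡m) (sym |w|≡1+n) ⟩
  r (suc ⟦ w ⟧ * (2 ^ length w ∸ 1))                 ≡⟨ r-mersenne-multiple w ⟩
  (pred (length w) + bit (lastBit w ∧ not (headBit w))) % 2 ≡⟨ cong₂ (λ l b → (pred l + bit (b ∧ not (headBit w))) % 2) |w|≡1+n (lastBit-∷ʳ (digits n m) false) ⟩
  (n + 0) % 2                                        ≡⟨ cong (_% 2) (+-identityʳ n) ⟩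
  n % 2                                              ∎
  where
  w = digits n m ∷ʳ false
  ⟦w⟧≡m : ⟦ w ⟧ ≡ m
  ⟦w⟧≡m = begin
    ⟦ digits n m ∷ʳ false ⟧                          ≡⟨ ⟦++⟧ (digits n m) (false ∷ []) ⟩
    ⟦ digits n m ⟧ + 2 ^ length (digits n m) * 0     ≡⟨ cong (⟦ digits n m ⟧ +_) (*-zeroʳ (2 ^ length (digits n m))) ⟩
    ⟦ digits n m ⟧ + 0                               ≡⟨ +-identityʳ _ ⟩
    ⟦ digits n m ⟧                                   ≡⟨ ⟦digits⟧ n m m<2^n ⟩
    m                                                ∎
  |w|≡1+n : length w ≡ suc n
  |w|≡1+n = trans (length-∷ʳ (digits n m) false) (cong suc (length-digits n m))

r-mersenne-multiple-2^n+1 : ∀ n → r ((2 ^ suc n + 1) * (2 ^ suc (suc n) ∸ 1)) ≡ suc (suc n) % 2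
r-mersenne-multiple-2^n+1 n = begin
  r ((2 ^ suc n + 1) * (2 ^ suc (suc n) ∸ 1))  ≡⟨ cong₂ (λ a l → r (a * (2 ^ l ∸ 1))) (trans (+-comm _ 1) (cong suc (sym (⟦w⟧ (suc n))))) (sym |w|≡2+n) ⟩
  r (suc ⟦ w ⟧ * (2 ^ length w ∸ 1))           ≡⟨ r-mersenne-multiple w ⟩
  (pred (length w) + bit (lastBit w ∧ true)) % 2 ≡⟨ cong₂ (λ l b → (pred l + bit (b ∧ true)) % 2) |w|≡2+n (lastBit-∷ʳ (replicate (suc n) false) true) ⟩
  (suc n + 1) % 2                              ≡⟨ cong (_% 2) (+-comm (suc n) 1) ⟩
  suc (suc n) % 2                              ∎
  where
  w = replicate (suc n) false ∷ʳ true
  |w|≡2+n : length w ≡ suc (suc n)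
  |w|≡2+n = trans (length-∷ʳ (replicate (suc n) false) true) (cong suc (length-replicate (suc n)))
  ⟦w⟧ : ∀ k → ⟦ replicate k false ∷ʳ true ⟧ ≡ 2 ^ k
  ⟦w⟧ zero    = refl
  ⟦w⟧ (suc k) = cong (2 *_) (⟦w⟧ k)

[2^[1+n]∸1+3]/2≡1+2^n : ∀ n → (2 ^ suc n ∸ 1 + 3) / 2 ≡ suc (2 ^ n)
[2^[1+n]∸1+3]/2≡1+2^n n = begin
  (2 * P ∸ 1 + 3) / 2     ≡⟨ cong (_/ 2) (+-assoc (2 * P ∸ 1) 1 2) ⟨
  (2 * P ∸ 1 + 1 + 2) / 2 ≡⟨ cong (λ x → (x + 2) / 2) (m∸n+n≡m 1≤2P) ⟩
  (2 * P + 2) / 2         ≡⟨ cong (_/ 2) (regroup P) ⟩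
  suc P * 2 / 2           ≡⟨ m*n/n≡m (suc P) 2 ⟩
  suc P                   ∎
  where
  P = 2 ^ n
  1≤2P : 1 ≤ 2 * P
  1≤2P = ≤-trans (m^n>0 2 n) (m≤m+n P _)
  regroup : ∀ p → 2 * p + 2 ≡ suc p * 2
  regroup = solve-∀

[1+n]%2≡1⇒n%2≡0 : ∀ n → suc n % 2 ≡ 1 → n % 2 ≡ 0
[1+n]%2≡1⇒n%2≡0 zero          _  = refl
[1+n]%2≡1⇒n%2≡0 (suc (suc n)) eq = [1+n]%2≡1⇒n%2≡0 n eq

proposition3p1 : (k : ℕ) → 3 ≤ k →
    ((j : ℕ) → 1 ≤ j → j ≤ 2 ^ (k ∸ 1) → r (j * (2 ^ k ∸ 1)) ≡ (k ∸ 1) % 2)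
    × (k % 2 ≡ 1 →
        (r ((2 ^ (k ∸ 1) + 1) * (2 ^ k ∸ 1)) ≡ k % 2)
        × IsA0 (2 ^ k ∸ 1) (((2 ^ k ∸ 1) + 3) / 2))
proposition3p1 (suc (suc (suc n))) (s≤s (s≤s (s≤s z≤n))) = up-to-2^K , odd-k
  where
  K = suc (suc n)
  d = 2 ^ suc K ∸ 1
  up-to-2^K : (j : ℕ) → 1 ≤ j → j ≤ 2 ^ K → r (j * d) ≡ K % 2
  up-to-2^K (suc m) _ j≤2^K = r-mersenne-multiple-< K m j≤2^K
  odd-k : suc K % 2 ≡ 1 → (r ((2 ^ K + 1) * d) ≡ suc K % 2) × IsA0 d ((d + 3) / 2)
  odd-k k-odd = r-mersenne-multiple-2^n+1 (suc n) , subst (IsA0 d) (sym ([2^[1+n]∸1+3]/2≡1+2^n K))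
    ( s≤s z≤n
    , (λ r≡0 → 1≢0 (trans (sym r-top≡1) r≡0))
    , λ l 1≤l l<1+2^K → trans (up-to-2^K l 1≤l (s≤s⁻¹ l<1+2^K)) ([1+n]%2≡1⇒n%2≡0 K k-odd) )
    where
    r-top≡1 : r (suc (2 ^ K) * d) ≡ 1
    r-top≡1 = trans (cong (λ a → r (a * d)) (+-comm 1 (2 ^ K))) (trans (r-mersenne-multiple-2^n+1 (suc n)) k-odd)
    1≢0 : 1 ≢ 0
    1≢0 ()
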